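{- Let $F$ be a finite poset and $\alpha$ any signature. Then $F\vDash\chi(\mathbb{T}_\alpha)$ if and only if $F$ is $\alpha$-connected.
   Context: A signature is either the empty signature $\epsilon$ or $\alpha=n_1^{m_1}\cdots n_k^{m_k}$ with integers $n_1>\cdots>n_k\geq1$, $m_i\geq1$. Its length is $|\alpha|=m_1+\cdots+m_k$ ($|\epsilon|=0$), and $\alpha(1)\geq\alpha(2)\geq\cdots\geq\alpha(|\alpha|)$ is the sequence listing each $n_i$ exactly $m_i$ times. The starlike tree $\mathbb{T}_\alpha$ is the poset consisting of a root together with, for each $i$, $m_i$ chains of $n_i$ elements, pairwise disjoint and incomparable and all above the root; $\mathbb{T}_\epsilon$ is a single point. For a finite rooted poset $Q$, $\chi(Q)$ is its Jankov–Fine formula: a poset $F$ validates $\chi(Q)$ (intuitionistic Kripke semantics) iff there is no surjective p-morphism from an upward-closed subset of $F$ onto $Q$. The height of a poset is $\sup\{|X|-1: X \text{ a chain}\}$. For $x\in F$, ${\uparrow}^{\circ}x=\{y\in F: y>x\}$. For a poset $G$ and signature $\alpha\neq\epsilon$, an $\alpha$-partition of $G$ is a partition $G=C_1\sqcup\cdots\sqcup C_{|\alpha|}$ into upward-closed sets such that $C_j$ has height at least $\alpha(j)-1$ for each $j$; $G$ has an $\epsilon$-partition iff $G=\varnothing$. A poset $F$ is $\alpha$-connected if there is no $x\in F$ such that ${\uparrow}^{\circ}x$ has an $\alpha$-partition. -}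

module Defs where

open import Data.Nat using (ℕ; zero; suc) renaming (_≤_ to _≤ℕ_; _≥_ to _≥ℕ_)
open import Data.Fin using (Fin) renaming (_<_ to _<ᶠ_; _≤_ to _≤ᶠ_)
open import Data.List using (List; []; _∷_; length; lookup)
open import Data.List.Relation.Unary.All using (All)
open import Data.List.Relation.Unary.Linked using (Linked)
open import Data.Maybe using (Maybe; just; nothing)
open import Data.Product using (Σ; ∃; _×_; _,_)
open import Data.Bool using (Bool; T)
open import Data.Empty using (⊥)
open import Data.Unit using (⊤)
open import Relation.Nullary using (¬_)
open import Relation.Binary.PropositionalEquality using (_≡_; _≢_)
open import Relation.Binary.Structures using (IsPartialOrder)

record FinPoset : Set₁ where
  field
    size      : ℕ
    _≤_       : Fin size → Fin size → Set
    isPartialOrder : IsPartialOrder _≡_ _≤_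

  Carrier : Set
  Carrier = Fin size

  _<_ : Carrier → Carrier → Set
  x < y = x ≤ y × x ≢ y

-- Signatures: α(1) ≥ α(2) ≥ … ≥ α(|α|) ≥ 1, as a list; [] is ε.

record Signature : Set where
  field
    seq      : List ℕ
    positive : All (λ k → 1 ≤ℕ k) seq
    nonincr  : Linked _≥ℕ_ seq

  len : ℕ
  len = length seq

  at : Fin len → ℕ
  at = lookup seq

open Signature public using (seq; len; at)

-- The starlike tree 𝕋_α: a root (nothing) and, for each j < |α|, a chain
-- of α(j) elements (just (j , k)), k = position in the chain.
TCarrier : Signature → Set
TCarrier α = Maybe (Σ (Fin (len α)) λ j → Fin (at α j))

data TLe (α : Signature) : TCarrier α → TCarrier α → Set where
  root≤   : ∀ {q} → TLe α nothing q
  chain≤  : ∀ {j} {k k' : Fin (at α j)} → k ≤ᶠ k' → TLe α (just (j , k)) (just (j , k'))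

module _ (F : FinPoset) where
  open FinPoset F

  IsUpSet : (Carrier → Bool) → Set
  IsUpSet U = ∀ x y → x ≤ y → T (U x) → T (U y)

  record SurjPMorphism (U : Carrier → Bool) (Q : Set) (_⊑_ : Q → Q → Set) : Set where
    field
      map   : (x : Carrier) → T (U x) → Q
      forth : ∀ x y (ux : T (U x)) (uy : T (U y)) → x ≤ y → map x ux ⊑ map y uy
      back  : ∀ x (ux : T (U x)) (q : Q) → map x ux ⊑ q →
              Σ Carrier λ y → x ≤ y × Σ (T (U y)) λ uy → map y uy ≡ q
      onto  : ∀ (q : Q) → Σ Carrier λ y → Σ (T (U y)) λ uy → map y uy ≡ q

  -- F ⊨ χ(Q): no surjective p-morphism from an up-set of F onto Q
  Validates : (Q : Set) → (Q → Q → Set) → Set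
  Validates Q _⊑_ = ¬ (Σ (Carrier → Bool) λ U → IsUpSet U × SurjPMorphism U Q _⊑_)

  StrictUp : Carrier → Carrier → Set
  StrictUp x y = x < y

  -- C (a subset of F) has height at least h - 1, i.e. contains a chain of
  -- h pairwise distinct elements (written as a strictly increasing sequence).
  HasChainOf : (Carrier → Set) → ℕ → Set
  HasChainOf C h = Σ (Fin h → Carrier) λ c →
    (∀ i → C (c i)) × (∀ i j → i <ᶠ j → c i < c j)

  record NonemptyPartition (α : Signature) (G : Carrier → Set) : Set where
    field
      block    : (y : Carrier) → G y → Fin (len α)
      upClosed : ∀ y z (gy : G y) (gz : G z) → y ≤ z → block z gz ≡ block y gy
      height   : ∀ j → HasChainOf (λ y → Σ (G y) λ gy → block y gy ≡ j) (at α j)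

  HasPartition : Signature → (Carrier → Set) → Set
  HasPartition α G with seq α
  ... | []    = ∀ y → ¬ G y
  ... | _ ∷ _ = NonemptyPartition α G

  Connected : Signature → Set
  Connected α = ¬ (Σ Carrier λ x → HasPartition α (StrictUp x))

{-# OPTIONS --safe #-}
-- If f maps an up-set of F onto 𝕋_α, pick x maximal in the fibre of the root.
-- Every y > x is sent into some branch of 𝕋_α, which is constant on up-sets,
-- and lifting the j-th branch along the back condition, starting from x, gives a
-- chain of α(j) points in block j: an α-partition of ↑°x. Conversely, from an
-- α-partition of ↑°x send x to the root and y > x into its block j at position
-- α(j) − 1 − depth y (truncated at 0), where depth y is the length of the longest
-- chain starting at y. Depth is antitone and drops by exactly one along some
-- cover, so above y every later position of its branch is attained: this is the
-- back condition, and the chain of length α(j) in block j gives surjectivity.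
-- The order of F is not assumed decidable, but both directions prove ⊥, so the
-- decidability of ≤ and the maximal point are obtained under double negation.
module Submission where

open import Defs
open import Data.Bool using (Bool; T)
open import Data.Bool.Properties using (T-irrelevant)
open import Data.Fin as Fin using (Fin; toℕ; fromℕ<)
import Data.Fin.Properties as Fin
open import Data.List using ([]; _∷_)
open import Data.List.Membership.Propositional.Properties using (∈-lookup)
import Data.List.Relation.Unary.All as All
open import Data.Maybe using (just; nothing)
open import Data.Nat as ℕ using (ℕ; zero; suc; _∸_; _+_; z≤n; s≤s)
import Data.Nat.Properties as ℕₚ
open import Data.Product using (Σ; _×_; _,_; proj₁; proj₂)
open import Data.Sum using (inj₁; inj₂)
open import Data.Unit using (⊤; tt)
open import Function using (_∘_; case_of_)
open import Function.Bundles using (_⇔_; mk⇔)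
open import Relation.Binary.Definitions using (Decidable)
import Relation.Binary.Construct.NonStrictToStrict as NonStrictToStrict
open import Relation.Binary.PropositionalEquality
  using (_≡_; _≢_; refl; sym; trans; cong; subst; subst₂; module ≡-Reasoning)
open import Relation.Binary.Structures using (IsPartialOrder)
import Relation.Unary as Unary
open import Relation.Nullary using (¬_; Dec; yes; no; contradiction)
open import Relation.Nullary.Decidable using (⌊_⌋; toWitness; fromWitness; _×-dec_; ¬¬-excluded-middle)

greatest-≤ : {P : ℕ → Set} → Unary.Decidable P → P 0 → (b : ℕ) →
             Σ ℕ λ m → P m × (∀ {d} → d ℕ.≤ b → P d → d ℕ.≤ m)
greatest-≤ P? p0 zero = 0 , p0 , λ d≤0 _ → d≤0
greatest-≤ P? p0 (suc b) with P? (suc b)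
... | yes p = suc b , p , λ d≤ _ → d≤
... | no ¬p with greatest-≤ P? p0 b
...   | m , pm , greatest = m , pm , λ {d} d≤ pd → case ℕₚ.m≤n⇒m<n∨m≡n d≤ of λ where
          (inj₁ d<) → greatest (ℕₚ.≤-pred d<) pd
          (inj₂ refl) → contradiction pd ¬p

m∸n≤o⇒m∸o≤n : ∀ m n o → m ∸ n ℕ.≤ o → m ∸ o ℕ.≤ n
m∸n≤o⇒m∸o≤n m n o m∸n≤o = ℕₚ.m≤n+o⇒m∸n≤o m o
  (subst (m ℕ.≤_) (ℕₚ.+-comm n o) (ℕₚ.≤-trans (ℕₚ.m≤n+m∸n m n) (ℕₚ.+-monoʳ-≤ n m∸n≤o)))

¬¬-∀-Fin : ∀ n {P : Fin n → Set} → (∀ i → ¬ ¬ P i) → ¬ ¬ (∀ i → P i)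
¬¬-∀-Fin zero _ ¬∀ = ¬∀ λ ()
¬¬-∀-Fin (suc n) ¬¬P ¬∀ = ¬¬P Fin.zero λ p₀ → ¬¬-∀-Fin n (¬¬P ∘ Fin.suc) λ ps →
  ¬∀ λ { Fin.zero → p₀ ; (Fin.suc i) → ps i }

pred<self : ∀ {n} → 1 ℕ.≤ n → ℕ.pred n ℕ.< n
pred<self {suc n} _ = ℕₚ.n<1+n n

at-positive : (α : Signature) (j : Fin (len α)) → 1 ℕ.≤ at α j
at-positive α j = All.lookup (Signature.positive α) (∈-lookup j)

MapsOnto : FinPoset → Signature → Set
MapsOnto F α = Σ (FinPoset.Carrier F → Bool) λ U → IsUpSet F U × SurjPMorphism F U (TCarrier α) (TLe α)

module _ (F : FinPoset) where
  open FinPoset F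
  open IsPartialOrder isPartialOrder using (antisym) renaming (refl to ≤-refl; trans to ≤-trans)
  open NonStrictToStrict _≡_ _≤_ using (<⇒≤)

  <-≤-trans : ∀ {x y z} → x < y → y ≤ z → x < z
  <-≤-trans = NonStrictToStrict.<-≤-trans _≡_ _≤_ sym ≤-trans antisym (λ { refl y≤z → y≤z })

  Increasing : ∀ {n} → (Fin n → Carrier) → Set
  Increasing c = ∀ i j → i Fin.< j → c i < c j

  Ascent : ℕ → Carrier → Set
  Ascent zero    y = ⊤
  Ascent (suc k) y = Σ Carrier λ z → y < z × Ascent k z

  ascent-points : ∀ k {y} → Ascent k y → Fin (suc k) → Carrier
  ascent-points k       {y} _             Fin.zero    = y
  ascent-points (suc k)     (_ , _ , asc) (Fin.suc i) = ascent-points k asc i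

  ascent-start-≤ : ∀ k {y} (asc : Ascent k y) i → y ≤ ascent-points k asc i
  ascent-start-≤ k       _               Fin.zero    = ≤-refl
  ascent-start-≤ (suc k) (_ , y<z , asc) (Fin.suc i) = ≤-trans (<⇒≤ y<z) (ascent-start-≤ k asc i)

  ascent-points-increasing : ∀ k {y} (asc : Ascent k y) → Increasing (ascent-points k asc)
  ascent-points-increasing (suc k) (_ , y<z , asc) Fin.zero    (Fin.suc j) _ =
    <-≤-trans y<z (ascent-start-≤ k asc j)
  ascent-points-increasing (suc k) (_ , _ , asc)   (Fin.suc i) (Fin.suc j) (s≤s i<j) =
    ascent-points-increasing k asc i j i<j

  ascent-length< : ∀ {k y} → Ascent k y → k ℕ.< size
  ascent-length< {k} asc with k ℕ.<? size
  ... | yes k<size = k<size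
  ... | no k≮size with Fin.pigeonhole (s≤s (ℕₚ.≮⇒≥ k≮size)) (ascent-points k asc)
  ...   | i , j , i<j , eq = contradiction eq (proj₂ (ascent-points-increasing k asc i j i<j))

  increasing⇒ascent : ∀ m (c : Fin (suc m) → Carrier) → Increasing c → Ascent m (c Fin.zero)
  increasing⇒ascent zero    c _   = tt
  increasing⇒ascent (suc m) c inc =
    c (Fin.suc Fin.zero) , inc Fin.zero (Fin.suc Fin.zero) (s≤s z≤n) ,
    increasing⇒ascent m (c ∘ Fin.suc) (λ i j i<j → inc (Fin.suc i) (Fin.suc j) (s≤s i<j))

  Maximal : (Carrier → Set) → Carrier → Set
  Maximal S x = S x × (∀ z → x < z → ¬ S z)

  ¬¬-maximal : ∀ {S y} → S y → ¬ ¬ Σ Carrier (Maximal S)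
  ¬¬-maximal = climb size (ℕₚ.<-irrefl refl ∘ ascent-length<)
    where
    climb : ∀ k {S y} → ¬ Ascent k y → S y → ¬ ¬ Σ Carrier (Maximal S)
    climb zero    ¬asc _  _    = ¬asc tt
    climb (suc k) {S} {y} ¬asc sy ¬max = ¬¬-excluded-middle {A = Σ Carrier λ z → y < z × S z} λ where
      (yes (z , y<z , sz)) → climb k (λ asc → ¬asc (z , y<z , asc)) sz ¬max
      (no ¬above)          → ¬max (y , sy , λ z y<z sz → ¬above (z , y<z , sz))

  ¬¬-decidable : ¬ ¬ Decidable _≤_
  ¬¬-decidable = ¬¬-∀-Fin size λ _ → ¬¬-∀-Fin size λ _ → ¬¬-excluded-middle

  module Depth (_≤?_ : Decidable _≤_) where
    _<?_ : Decidable _<_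
    _<?_ = NonStrictToStrict.<-decidable _≡_ _≤_ Fin._≟_ _≤?_

    ascent? : ∀ k → Unary.Decidable (Ascent k)
    ascent? zero    _ = yes tt
    ascent? (suc k) y = Fin.any? λ z → y <? z ×-dec ascent? k z

    private
      longest : ∀ y → Σ ℕ λ m → Ascent m y × (∀ {d} → d ℕ.≤ size → Ascent d y → d ℕ.≤ m)
      longest y = greatest-≤ (λ k → ascent? k y) tt size

    depth : Carrier → ℕ
    depth y = proj₁ (longest y)

    depth-ascent : ∀ y → Ascent (depth y) y
    depth-ascent y = proj₁ (proj₂ (longest y))

    ascent⇒≤depth : ∀ {k y} → Ascent k y → k ℕ.≤ depth y
    ascent⇒≤depth {y = y} asc = proj₂ (proj₂ (longest y)) (ℕₚ.<⇒≤ (ascent-length< asc)) asc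

    depth-< : ∀ {y z} → y < z → depth z ℕ.< depth y
    depth-< {z = z} y<z = ascent⇒≤depth (z , y<z , depth-ascent z)

    depth-antitone : ∀ {y z} → y ≤ z → depth z ℕ.≤ depth y
    depth-antitone {y} {z} y≤z with y Fin.≟ z
    ... | yes refl = ℕₚ.≤-refl
    ... | no y≢z   = ℕₚ.<⇒≤ (depth-< (y≤z , y≢z))

    depth-step : ∀ {y d} → depth y ≡ suc d → Σ Carrier λ z → y < z × depth z ≡ d
    depth-step {y} eq with subst (λ k → Ascent k y) eq (depth-ascent y)
    ... | z , y<z , asc =
      z , y<z , ℕₚ.≤-antisym (ℕₚ.≤-pred (subst (depth z ℕ.<_) eq (depth-< y<z))) (ascent⇒≤depth asc)

    depth-attained : ∀ {s} y → s ℕ.≤ depth y → Σ Carrier λ z → y ≤ z × depth z ≡ s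
    depth-attained {s} y s≤ = descend (depth y ∸ s) y (sym (ℕₚ.m∸n+n≡m s≤))
      where
      descend : ∀ r y → depth y ≡ r + s → Σ Carrier λ z → y ≤ z × depth z ≡ s
      descend zero    y eq = y , ≤-refl , eq
      descend (suc r) y eq with depth-step eq
      ... | w , y<w , eqw with descend r w eqw
      ...   | z , w≤z , eqz = z , ≤-trans (<⇒≤ y<w) w≤z , eqz

    increasing⇒≤depth : ∀ {n} (c : Fin n → Carrier) → Increasing c → Fin n →
                        Σ (Fin n) λ i → ℕ.pred n ℕ.≤ depth (c i)
    increasing⇒≤depth {suc m} c inc _ = Fin.zero , ascent⇒≤depth (increasing⇒ascent m c inc)

  NonemptyPartition⇒HasPartition : ∀ α {G} → NonemptyPartition F α G → HasPartition F α G
  NonemptyPartition⇒HasPartition record { seq = [] }    P y Gy = case NonemptyPartition.block P y Gy of λ ()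
  NonemptyPartition⇒HasPartition record { seq = _ ∷ _ } P      = P

  module FromPMorphism (α : Signature) {U : Carrier → Bool} (U-up : IsUpSet F U)
                       (f : SurjPMorphism F U (TCarrier α) (TLe α)) where
    open SurjPMorphism f

    map-cong : ∀ {y y'} → y ≡ y' → (u : T (U y)) (u' : T (U y')) → map y u ≡ map y' u'
    map-cong refl u u' = cong (map _) (T-irrelevant u u')

    RootFibre : Carrier → Set
    RootFibre y = Σ (T (U y)) λ u → map y u ≡ nothing

    branch : {q : TCarrier α} → q ≢ nothing → Fin (len α)
    branch {just (j , _)} _  = j
    branch {nothing}      q≢ = contradiction refl q≢

    branch-just : ∀ {q j k} (q≢ : q ≢ nothing) → q ≡ just (j , k) → branch q≢ ≡ j
    branch-just _ refl = refl

    branch-TLe : ∀ {q q'} → TLe α q q' → (q≢ : q ≢ nothing) (q'≢ : q' ≢ nothing) →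
                 branch q'≢ ≡ branch q≢
    branch-TLe root≤      q≢ _ = contradiction refl q≢
    branch-TLe (chain≤ _) _  _ = refl

    position : TCarrier α → ℕ
    position (just (_ , k)) = toℕ k
    position nothing        = 0

    module AboveMaximal {x} (x-max : Maximal RootFibre x) where
      above-inU : ∀ {y} → x < y → T (U y)
      above-inU x<y = U-up _ _ (proj₁ x<y) (proj₁ (proj₁ x-max))

      above-nonroot : ∀ {y} (x<y : x < y) → map y (above-inU x<y) ≢ nothing
      above-nonroot x<y eq = proj₂ x-max _ x<y (above-inU x<y , eq)

      block : ∀ y → x < y → Fin (len α)
      block y x<y = branch (above-nonroot x<y)

      block-upClosed : ∀ y z (x<y : x < y) (x<z : x < z) → y ≤ z → block z x<z ≡ block y x<y
      block-upClosed y z _ _ y≤z = branch-TLe (forth y z _ _ y≤z) _ _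

      module Branch (j : Fin (len α)) where
        -- Stage i lies at position i − 1 of branch j, stage 0 at the root; past
        -- the end of the branch the condition is vacuous.
        Level : ℕ → TCarrier α → Set
        Level zero    q = q ≡ nothing
        Level (suc i) q = (i<n : i ℕ.< at α j) → q ≡ just (j , fromℕ< i<n)

        level-below : ∀ i {q} → Level i q → (i<n : i ℕ.< at α j) → TLe α q (just (j , fromℕ< i<n))
        level-below zero    refl _ = root≤
        level-below (suc i) lvl i<n rewrite lvl (ℕₚ.<-trans (ℕₚ.n<1+n i) i<n) =
          chain≤ (subst₂ ℕ._≤_ (sym (Fin.toℕ-fromℕ< _)) (sym (Fin.toℕ-fromℕ< i<n)) (ℕₚ.n≤1+n i))

        record Stage (i : ℕ) : Set where
          field
            point : Carrier
            inU   : T (U point)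
            level : Level i (map point inU)
        open Stage

        next : ∀ {i} (s : Stage i) → Σ (Stage (suc i)) λ s' → point s ≤ point s'
        next {i} s with i ℕ.<? at α j
        ... | no i≮n =
          record { point = point s ; inU = inU s ; level = λ i<n → contradiction i<n i≮n } , ≤-refl
        ... | yes i<n with back (point s) (inU s) _ (level-below i (level s) i<n)
        ...   | z , s≤z , u , eq = record { point = z ; inU = u ; level = λ _ → eq } , s≤z

        stage : ∀ i → Stage i
        stage zero    = record { point = x ; inU = proj₁ (proj₁ x-max) ; level = proj₂ (proj₁ x-max) }
        stage (suc i) = proj₁ (next (stage i))

        stage-mono : ∀ {i i'} → i ℕ.≤′ i' → point (stage i) ≤ point (stage i')
        stage-mono ℕ.≤′-refl        = ≤-refl
        stage-mono (ℕ.≤′-step i≤i') = ≤-trans (stage-mono i≤i') (proj₂ (next (stage _)))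

        chain : Fin (at α j) → Carrier
        chain k = point (stage (suc (toℕ k)))

        chain-image : ∀ k → map (chain k) (inU (stage (suc (toℕ k)))) ≡ just (j , k)
        chain-image k = trans (level (stage (suc (toℕ k))) (Fin.toℕ<n k))
                              (cong (λ k' → just (j , k')) (Fin.fromℕ<-toℕ k _))

        x<chain : ∀ k → x < chain k
        x<chain k = stage-mono {i' = suc (toℕ k)} (ℕₚ.≤⇒≤′ z≤n) ,
          λ x≡ → contradiction (trans (sym (proj₂ (proj₁ x-max)))
                                      (trans (map-cong x≡ _ _) (chain-image k))) λ ()

        chain-block : ∀ k → block (chain k) (x<chain k) ≡ j
        chain-block k = branch-just _ (trans (map-cong refl _ _) (chain-image k))

        chain-increasing : Increasing chain
        chain-increasing k k' k<k' =
          stage-mono {suc (toℕ k)} {suc (toℕ k')} (ℕₚ.≤⇒≤′ (s≤s (ℕₚ.<⇒≤ k<k'))) ,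
          λ eq → ℕₚ.<-irrefl (cong position (trans (sym (chain-image k))
                                                    (trans (map-cong eq _ _) (chain-image k')))) k<k'

        height : HasChainOf F (λ y → Σ (x < y) λ x<y → block y x<y ≡ j) (at α j)
        height = chain , (λ k → x<chain k , chain-block k) , chain-increasing

      partition : NonemptyPartition F α (StrictUp F x)
      partition = record { block = block ; upClosed = block-upClosed ; height = Branch.height }

  Connected⇒Validates : ∀ α → Connected F α → Validates F (TCarrier α) (TLe α)
  Connected⇒Validates α con (U , U-up , f) =
    let x₀ , u₀ , e₀ = SurjPMorphism.onto f nothing in
    ¬¬-maximal (u₀ , e₀) λ (x , x-max) →
      con (x , NonemptyPartition⇒HasPartition α (FromPMorphism.AboveMaximal.partition α U-up f x-max))

  module ToPMorphism (α : Signature) (_≤?_ : Decidable _≤_) {x} (P : NonemptyPartition F α (StrictUp F x)) where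
    open Depth _≤?_
    open NonemptyPartition P

    U : Carrier → Bool
    U y = ⌊ x ≤? y ⌋

    U-up : IsUpSet F U
    U-up y z y≤z x≤y = fromWitness (≤-trans (toWitness x≤y) y≤z)

    top : Fin (len α) → ℕ
    top j = ℕ.pred (at α j)

    index : ∀ j → Carrier → Fin (at α j)
    index j y = fromℕ< (ℕₚ.≤-<-trans (ℕₚ.m∸n≤m (top j) (depth y)) (pred<self (at-positive α j)))

    toℕ-index : ∀ {j y} → toℕ (index j y) ≡ top j ∸ depth y
    toℕ-index = Fin.toℕ-fromℕ< _

    index-antitone : ∀ j {y z} → depth z ℕ.≤ depth y → index j y Fin.≤ index j z
    index-antitone j d≤ = subst₂ ℕ._≤_ (sym toℕ-index) (sym toℕ-index) (ℕₚ.∸-monoʳ-≤ (top j) d≤)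

    index-at-depth : ∀ {j z} (k : Fin (at α j)) → depth z ≡ top j ∸ toℕ k → index j z ≡ k
    index-at-depth {j} k eq = Fin.toℕ-injective (begin
      toℕ (index j _)        ≡⟨ toℕ-index ⟩
      top j ∸ depth _        ≡⟨ cong (top j ∸_) eq ⟩
      top j ∸ (top j ∸ toℕ k) ≡⟨ ℕₚ.m∸[m∸n]≡n (ℕₚ.suc[m]≤n⇒m≤pred[n] (Fin.toℕ<n k)) ⟩
      toℕ k                  ∎)
      where open ≡-Reasoning

    TLe-index : ∀ {y z jy jz} → jz ≡ jy → depth z ℕ.≤ depth y →
                TLe α (just (jy , index jy y)) (just (jz , index jz z))
    TLe-index refl d≤ = chain≤ (index-antitone _ d≤)

    just-index : ∀ {j' j z} {k : Fin (at α j)} → j' ≡ j → depth z ≡ top j ∸ toℕ k →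
                 just (j' , index j' z) ≡ just (j , k)
    just-index refl eq = cong (λ k → just (_ , k)) (index-at-depth _ eq)

    image : ∀ y → x ≤ y → Dec (y ≡ x) → TCarrier α
    image y _   (yes _)  = nothing
    image y x≤y (no y≢x) = just (block y (x≤y , y≢x ∘ sym) , index _ y)

    project : (y : Carrier) → T (U y) → TCarrier α
    project y x≤y = image y (toWitness x≤y) (y Fin.≟ x)

    project-root : ∀ u → project x u ≡ nothing
    project-root u with x Fin.≟ x
    ... | yes _   = refl
    ... | no x≢x = contradiction refl x≢x

    project-forth : ∀ y z uy uz → y ≤ z → TLe α (project y uy) (project z uz)
    project-forth y z uy uz y≤z with y Fin.≟ x | z Fin.≟ x
    ... | yes _   | _        = root≤
    ... | no y≢x  | yes refl = contradiction (antisym y≤z (toWitness uy)) y≢x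
    ... | no _    | no _     = TLe-index (upClosed y z _ _ y≤z) (depth-antitone y≤z)

    Reachable : Carrier → TCarrier α → Set
    Reachable y q = Σ Carrier λ z → y ≤ z × Σ (T (U z)) λ u → project z u ≡ q

    reach : ∀ {y j} (x<y : x < y) → block y x<y ≡ j → (k : Fin (at α j)) →
            top j ∸ toℕ k ℕ.≤ depth y → Reachable y (just (j , k))
    reach {y} {j} x<y y∈j k k-low with depth-attained y k-low
    ... | z , y≤z , depth-z = z , y≤z , fromWitness x≤z , image-z _ (z Fin.≟ x)
      where
      x≤z : x ≤ z
      x≤z = ≤-trans (proj₁ x<y) y≤z

      image-z : (x≤z' : x ≤ z) (d : Dec (z ≡ x)) → image z x≤z' d ≡ just (j , k)
      image-z _ (yes refl) = contradiction (antisym (proj₁ x<y) y≤z) (proj₂ x<y)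
      image-z _ (no _)     = just-index (trans (upClosed y z x<y _ y≤z) y∈j) depth-z

    project-onto : ∀ q → Σ Carrier λ z → Σ (T (U z)) λ u → project z u ≡ q
    project-onto nothing = x , fromWitness ≤-refl , project-root _
    project-onto (just (j , k)) with height j
    ... | c , c∈j , c-inc with increasing⇒≤depth c c-inc k
    ...   | i , top≤
          with reach (proj₁ (c∈j i)) (proj₂ (c∈j i)) k (ℕₚ.≤-trans (ℕₚ.m∸n≤m (top j) (toℕ k)) top≤)
    ...     | z , _ , u , gz = z , u , gz

    project-back : ∀ y uy q → TLe α (project y uy) q → Reachable y q
    project-back y uy q le with y Fin.≟ x
    project-back y uy q le | yes refl with project-onto q
    ... | z , u , gz = z , toWitness u , u , gz
    project-back y uy _ (chain≤ {k' = k'} le) | no y≢x =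
      reach (toWitness uy , y≢x ∘ sym) refl k'
            (m∸n≤o⇒m∸o≤n _ _ _ (subst (ℕ._≤ toℕ k') toℕ-index le))

    mapsOnto : MapsOnto F α
    mapsOnto = U , U-up , record
      { map = project ; forth = project-forth ; back = project-back ; onto = project-onto }

  top-point-mapsOnto : ∀ α → ¬ Fin (len α) → ∀ x → (∀ y → ¬ x < y) → MapsOnto F α
  top-point-mapsOnto α no-branch x x-top = U , U-up , record
    { map   = λ _ _ → nothing
    ; forth = λ _ _ _ _ _ → root≤
    ; back  = λ { y u nothing _ → y , ≤-refl , u , refl
                ; _ _ (just (j , _)) _ → contradiction j no-branch }
    ; onto  = λ { nothing → x , fromWitness refl , refl
                ; (just (j , _)) → contradiction j no-branch }
    }
    where
    U : Carrier → Bool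
    U y = ⌊ y Fin.≟ x ⌋

    U-up : IsUpSet F U
    U-up y z y≤z y≡x with z Fin.≟ x
    ... | yes _   = tt
    ... | no z≢x = contradiction (subst (_≤ z) (toWitness y≡x) y≤z , z≢x ∘ sym) (x-top z)

  Validates⇒Connected : ∀ α → Validates F (TCarrier α) (TLe α) → Connected F α
  Validates⇒Connected α@record { seq = [] }    V (x , x-top) = V (top-point-mapsOnto α (λ ()) x x-top)
  Validates⇒Connected α@record { seq = _ ∷ _ } V (x , P)     =
    ¬¬-decidable λ _≤?_ → V (ToPMorphism.mapsOnto α _≤?_ P)

theorem6p7 : (F : FinPoset) (α : Signature) →
    Validates F (TCarrier α) (TLe α) ⇔ Connected F α
theorem6p7 F α = mk⇔ (Validates⇒Connected F α) (Connected⇒Validates F α)
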